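{- Let $t$ be an ordinal tree with $n$ nodes, let $B\ge 1$, and let $\mathcal{C}$ be the tree cover of $t$ produced by the Farzan–Munro algorithm with parameter $B$. Construct $t'$ and the modified tree cover as described in the context. Then the modified tree cover satisfies: (1) the number of micro trees is $\mathrm{O}(n/B)$; (2) each micro tree either consists of a single node (with an arbitrary number of child micro trees), or consists of fewer than $2B$ nodes and has at most one child micro tree.
   Context: An ordinal tree is a rooted tree in which the children of each node are ordered. The Farzan–Munro tree-covering algorithm with parameter $B$ produces a collection of micro trees, each a connected set of nodes of $t$ (hence a subtree rooted at its topmost node, its root), covering all nodes, such that any two micro trees are disjoint or share only their common root; it is known that there are $\mathrm{O}(n/B)$ micro trees, each has fewer than $2B$ nodes, and each micro tree has at most one edge from one of its non-root nodes to a node outside it. Modified tree cover: for each micro tree $\mu$ of $\mathcal{C}$ with more than one node and root $v$, create a new dummy node $w$ as a child of $v$ and make the children of $v$ that lie in $\mu$ children of $w$ instead (keeping their order); let $t'$ be the resulting tree. The micro tree $\mu$ is replaced by two micro trees: the singleton $\{v\}$ and $\{w\}\cup(\mu\setminus\{v\})$ (rooted at $w$); single-node micro trees of $\mathcal{C}$ are kept (identical singletons are identified). A micro tree $\nu$ is a child micro tree of a micro tree $\mu$ if the parent in $t'$ of the root of $\nu$ lies in $\mu$. -}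

module Defs where

open import Data.Nat using (ℕ; zero; suc; _+_; _*_; _≤_; _<_; _≤?_)
open import Data.Fin as Fin using (Fin)
open import Data.List using (List; []; _∷_; length; lookup; map; filter; concatMap; allFin)
open import Data.List.Membership.Propositional using (_∈_; _∉_)
open import Data.List.Relation.Unary.Unique.Propositional using (Unique)
open import Data.Maybe using (Maybe; just; nothing; maybe′)
open import Data.Product using (Σ; ∃; ∃-syntax; _×_; _,_; proj₁)
open import Data.Sum using (_⊎_; inj₁; inj₂)
open import Relation.Nullary using (Dec; yes; no; ¬_; ¬?)
open import Relation.Binary.PropositionalEquality using (_≡_; _≢_; refl)

-- Ordinal trees (rose trees: children are ordered by the list order)

data Tree : Set where
  node : List Tree → Tree

mutual
  size : Tree → ℕ
  size (node ts) = suc (sizes ts)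

  sizes : List Tree → ℕ
  sizes []       = 0
  sizes (t ∷ ts) = size t + sizes ts

-- Nodes of a tree, addressed by their path from the root.
data Pos : Tree → Set where
  here  : ∀ {ts} → Pos (node ts)
  child : ∀ {ts} (i : Fin (length ts)) → Pos (lookup ts i) → Pos (node ts)

parent : ∀ {t} → Pos t → Maybe (Pos t)
parent here        = nothing
parent (child i p) = just (maybe′ (child i) here (parent p))

ParentOf : (t : Tree) → Pos t → Pos t → Set
ParentOf t x p = parent x ≡ just p

_≟P_ : ∀ {t} (p q : Pos t) → Dec (p ≡ q)
here ≟P here = yes refl
here ≟P child _ _ = no λ ()
child _ _ ≟P here = no λ ()
child i p ≟P child j q with i Fin.≟ j
... | no i≢j = no λ { refl → i≢j refl }
... | yes refl with p ≟P q
...   | yes refl = yes refl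
...   | no p≢q = no λ { refl → p≢q refl }

-- Micro trees over a node type N with a parent relation Par
-- (Par x p : p is the parent of x).

record MicroTree (N : Set) : Set where
  constructor mkMicro
  field
    root  : N
    nodes : List N
open MicroTree public

SameSet : ∀ {N : Set} → List N → List N → Set
SameSet xs ys = (∀ {x} → x ∈ xs → x ∈ ys) × (∀ {y} → y ∈ ys → y ∈ xs)

module _ {N : Set} (Par : N → N → Set) where

  IsMicroTree : MicroTree N → Set
  IsMicroTree μ =
    root μ ∈ nodes μ × Unique (nodes μ) ×
    (∀ x → x ∈ nodes μ → x ≡ root μ ⊎ (∃[ y ] (Par x y × y ∈ nodes μ)))

  ChildMicro : MicroTree N → MicroTree N → Set
  ChildMicro ν μ = ∃[ p ] (Par (root ν) p × p ∈ nodes μ)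

AtMostDistinct : ∀ {N : Set} → ℕ → List (MicroTree N) → Set
AtMostDistinct {N} m L =
  ∃[ R ] (length R ≤ m ×
          (∀ {μ} → μ ∈ L → ∃[ ν ] (ν ∈ R × SameSet (nodes μ) (nodes ν))))

record FarzanMunroCover (t : Tree) (B k : ℕ) (C : Fin k → MicroTree (Pos t)) : Set where
  field
    micro    : ∀ i → IsMicroTree (ParentOf t) (C i)
    covers   : ∀ (x : Pos t) → ∃[ i ] (x ∈ nodes (C i))
    sharing  : ∀ i j → i ≢ j → ∀ x → x ∈ nodes (C i) → x ∈ nodes (C j) →
               x ≡ root (C i) × x ≡ root (C j)
    distinct : ∀ i j → SameSet (nodes (C i)) (nodes (C j)) → i ≡ j
    small    : ∀ i → length (nodes (C i)) < 2 * B
    oneEdge  : ∀ i x₁ y₁ x₂ y₂ →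
               x₁ ∈ nodes (C i) → x₁ ≢ root (C i) → ParentOf t y₁ x₁ → y₁ ∉ nodes (C i) →
               x₂ ∈ nodes (C i) → x₂ ≢ root (C i) → ParentOf t y₂ x₂ → y₂ ∉ nodes (C i) →
               x₁ ≡ x₂ × y₁ ≡ y₂

module Modified (t : Tree) (k : ℕ) (C : Fin k → MicroTree (Pos t)) where

  Nontrivial : Fin k → Set
  Nontrivial i = 2 ≤ length (nodes (C i))

  Dummy : Set
  Dummy = Σ (Fin k) Nontrivial

  Node′ : Set
  Node′ = Pos t ⊎ Dummy

  data Par′ : Node′ → Node′ → Set where
    dummy      : ∀ (d : Dummy) → Par′ (inj₂ d) (inj₁ (root (C (proj₁ d))))
    redirected : ∀ x p (d : Dummy) → ParentOf t x p → p ≡ root (C (proj₁ d)) →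
                 x ∈ nodes (C (proj₁ d)) → Par′ (inj₁ x) (inj₂ d)
    kept       : ∀ x p → ParentOf t x p →
                 (∀ (d : Dummy) → x ∈ nodes (C (proj₁ d)) → p ≢ root (C (proj₁ d))) →
                 Par′ (inj₁ x) (inj₁ p)

  singleton : Pos t → MicroTree Node′
  singleton v = mkMicro (inj₁ v) (inj₁ v ∷ [])

  lower : Dummy → MicroTree Node′
  lower d = mkMicro (inj₂ d)
    (inj₂ d ∷ map inj₁ (filter (λ x → ¬? (x ≟P root (C (proj₁ d)))) (nodes (C (proj₁ d)))))

  keep : Fin k → MicroTree Node′
  keep i = mkMicro (inj₁ (root (C i))) (map inj₁ (nodes (C i)))

  pieces : (i : Fin k) → Dec (Nontrivial i) → List (MicroTree Node′)
  pieces i (yes h) = singleton (root (C i)) ∷ lower (i , h) ∷ []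
  pieces i (no _)  = keep i ∷ []

  -- the modified tree cover (as a list; identical singletons may be repeated,
  -- and are identified by AtMostDistinct / SameSet)
  cover′ : List (MicroTree Node′)
  cover′ = concatMap (λ i → pieces i (2 ≤? length (nodes (C i)))) (allFin k)

-- The conclusion of the theorem for the modified cover, with O-constant c′:
-- (1) number of (distinct) micro trees ≤ c′ (n/B + 1), written without division;
-- (2) each micro tree is a single node, or has < 2B nodes and at most one
--     child micro tree.
ModifiedCoverProperties : (t : Tree) (B k : ℕ) (C : Fin k → MicroTree (Pos t)) → ℕ → Set
ModifiedCoverProperties t B k C c′ =
  (∃[ m ] (m * B ≤ c′ * (size t + B) × AtMostDistinct m cover′)) ×
  (∀ {μ} → μ ∈ cover′ →
     length (nodes μ) ≡ 1 ⊎
     (length (nodes μ) < 2 * B ×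
      (∀ {ν₁ ν₂} → ν₁ ∈ cover′ → ν₂ ∈ cover′ →
         ChildMicro Par′ ν₁ μ → ChildMicro Par′ ν₂ μ → SameSet (nodes ν₁) (nodes ν₂))))
  where open Modified t k C

{-# OPTIONS --safe #-}
-- Each micro tree of C yields at most two micro trees of the modified cover, so
-- there are at most 2k of them. Every non-singleton micro tree is a lower part
-- {w} ∪ (μ ∖ {v}). A child micro tree of it cannot be another lower part (their
-- dummies hang off roots of C, which the lower part excludes), nor be attached to
-- w (the redirected children of v lie in μ, and a root of C lying in μ is v); so
-- it is a singleton {y} with y a child, outside μ, of a non-root node of μ. The
-- Farzan–Munro cover has at most one such edge per micro tree.
module Submission where

open import Defs
open import Data.Nat using (ℕ; _+_; _*_; _≤_)
open import Data.Fin using (Fin)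
open import Data.Product using (∃-syntax)

open import Data.Nat using (zero; suc; _<_; _≤?_; z≤n; s≤s)
open import Data.Nat.Properties
open import Data.Fin.Properties using () renaming (_≟_ to _≟ᶠ_)
open import Data.List using (List; []; _∷_; length; map; filter; concatMap; allFin; _++_)
open import Data.List.Properties using (length-++; length-map; length-tabulate; filter-notAll)
open import Data.List.Membership.Propositional using (_∈_; _∉_)
open import Data.List.Membership.Propositional.Properties using (∈-concatMap⁻; ∈-map⁻; ∈-filter⁻)
open import Data.List.Relation.Unary.Any using (here; there; satisfied)
import Data.List.Relation.Unary.Any as Any
open import Data.Maybe using (just; nothing)
open import Data.Product using (_×_; _,_; proj₁; proj₂)
open import Data.Sum using (_⊎_; inj₁; inj₂)
open import Relation.Nullary using (Dec; yes; no; ¬_; ¬?; contradiction)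
open import Relation.Binary.PropositionalEquality
open import Function using (id)

length-concatMap-≤ : ∀ {A B : Set} (f : A → List B) {m} → (∀ x → length (f x) ≤ m) →
                     ∀ xs → length (concatMap f xs) ≤ m * length xs
length-concatMap-≤ f h [] = z≤n
length-concatMap-≤ f {m} h (x ∷ xs) = begin
  length (f x ++ concatMap f xs)          ≡⟨ length-++ (f x) ⟩
  length (f x) + length (concatMap f xs)  ≤⟨ +-mono-≤ (h x) (length-concatMap-≤ f h xs) ⟩
  m + m * length xs                       ≡⟨ sym (*-suc m (length xs)) ⟩
  m * suc (length xs)                     ∎
  where open ≤-Reasoning

length≱2⇒≡[_] : ∀ {A : Set} {x : A} {xs} → x ∈ xs → ¬ (2 ≤ length xs) → xs ≡ x ∷ []
length≱2⇒≡[_] {xs = _ ∷ []}    (here refl) _ = refl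
length≱2⇒≡[_] {xs = _ ∷ _ ∷ _} _           h = contradiction (s≤s (s≤s z≤n)) h

depth : ∀ {t} → Pos t → ℕ
depth here        = 0
depth (child _ p) = suc (depth p)

parent≡nothing⇒depth≡0 : ∀ {t} (x : Pos t) → parent x ≡ nothing → depth x ≡ 0
parent≡nothing⇒depth≡0 here _ = refl

ParentOf⇒depth≡suc : ∀ {t} (x : Pos t) {p} → ParentOf t x p → depth x ≡ suc (depth p)
ParentOf⇒depth≡suc (child i x) eq with parent x in e
... | nothing with refl ← eq = cong suc (parent≡nothing⇒depth≡0 x e)
... | just q  with refl ← eq = cong suc (ParentOf⇒depth≡suc x e)

module _ {t : Tree} {μ : MicroTree (Pos t)} (isμ : IsMicroTree (ParentOf t) μ) where

  depth-root≤ : ∀ n {x} → depth x ≡ n → x ∈ nodes μ → depth (root μ) ≤ n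
  depth-root≤ n {x} dx x∈ with proj₂ (proj₂ isμ) x x∈
  ... | inj₁ refl = ≤-reflexive dx
  depth-root≤ zero    {x} dx x∈ | inj₂ (y , x→y , _) =
    contradiction (trans (sym (ParentOf⇒depth≡suc x x→y)) dx) λ ()
  depth-root≤ (suc n) {x} dx x∈ | inj₂ (y , x→y , y∈) =
    m≤n⇒m≤1+n (depth-root≤ n (suc-injective (trans (sym (ParentOf⇒depth≡suc x x→y)) dx)) y∈)

  parent-root∉ : ∀ {p} → ParentOf t (root μ) p → p ∉ nodes μ
  parent-root∉ {p} r→p p∈ =
    1+n≰n (subst (_≤ depth p) (ParentOf⇒depth≡suc (root μ) r→p) (depth-root≤ (depth p) refl p∈))

module _ {t : Tree} {B k : ℕ} {C : Fin k → MicroTree (Pos t)} (FM : FarzanMunroCover t B k C) where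
  open FarzanMunroCover FM
  open Modified t k C

  root∈ : ∀ i → root (C i) ∈ nodes (C i)
  root∈ i = proj₁ (micro i)

  root-∈⇒≡ : ∀ i j → root (C j) ∈ nodes (C i) → root (C j) ≡ root (C i)
  root-∈⇒≡ i j r∈ with i ≟ᶠ j
  ... | yes refl = refl
  ... | no i≢j   = proj₁ (sharing i j i≢j _ r∈ (root∈ j))

  ∈-lower⁻ : ∀ d {x} → inj₁ x ∈ nodes (lower d) →
             x ∈ nodes (C (proj₁ d)) × x ≢ root (C (proj₁ d))
  ∈-lower⁻ d (there x∈) with ∈-map⁻ inj₁ x∈
  ... | _ , x∈′ , refl = ∈-filter⁻ (λ z → ¬? (z ≟P root (C (proj₁ d)))) x∈′

  dummy-∈-lower⁻ : ∀ d {d′} → inj₂ d′ ∈ nodes (lower d) → d′ ≡ d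
  dummy-∈-lower⁻ d (here refl) = refl
  dummy-∈-lower⁻ d (there x∈) with ∈-map⁻ inj₁ x∈
  ... | _ , _ , ()

  root-∉-lower : ∀ d j → inj₁ (root (C j)) ∉ nodes (lower d)
  root-∉-lower d j r∈ with ∈-lower⁻ d r∈
  ... | r∈′ , r≢ = r≢ (root-∈⇒≡ (proj₁ d) j r∈′)

  lower-small : ∀ d → length (nodes (lower d)) < 2 * B
  lower-small (i , _) = begin-strict
    suc (length (map inj₁ (filter P? (nodes (C i))))) ≡⟨ cong suc (length-map inj₁ (filter P? (nodes (C i)))) ⟩
    suc (length (filter P? (nodes (C i))))             ≤⟨ filter-notAll P? (nodes (C i)) (Any.map (λ { refl ¬r → ¬r refl }) (root∈ i)) ⟩
    length (nodes (C i))                               <⟨ small i ⟩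
    2 * B                                              ∎
    where
      open ≤-Reasoning
      P? = λ z → ¬? (z ≟P root (C i))

  data Piece : MicroTree Node′ → Set where
    lowerPiece : ∀ d → Piece (lower d)
    rootPiece  : ∀ j {ys} → ys ≡ inj₁ (root (C j)) ∷ [] → Piece (mkMicro (inj₁ (root (C j))) ys)

  pieces-Piece : ∀ i (dec : Dec (Nontrivial i)) {μ} → μ ∈ pieces i dec → Piece μ
  pieces-Piece i (yes h) (here refl)         = rootPiece i refl
  pieces-Piece i (yes h) (there (here refl)) = lowerPiece (i , h)
  pieces-Piece i (no h)  (here refl)         = rootPiece i (cong (map inj₁) (length≱2⇒≡[ root∈ i ] h))

  cover′-Piece : ∀ {μ} → μ ∈ cover′ → Piece μ
  cover′-Piece μ∈ with satisfied (∈-concatMap⁻ (λ i → pieces i (2 ≤? length (nodes (C i)))) {xs = allFin k} μ∈)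
  ... | i , μ∈′ = pieces-Piece i _ μ∈′

  length-cover′ : length cover′ ≤ 2 * k
  length-cover′ = subst (λ n → length cover′ ≤ 2 * n) (length-tabulate {n = k} id)
    (length-concatMap-≤ _ (λ i → length-pieces i (2 ≤? length (nodes (C i)))) (allFin k))
    where
      length-pieces : ∀ i (dec : Dec (Nontrivial i)) → length (pieces i dec) ≤ 2
      length-pieces i (yes _) = ≤-refl
      length-pieces i (no _)  = s≤s z≤n

  ExitEdge : Fin k → Pos t → Pos t → Set
  ExitEdge i x y = x ∈ nodes (C i) × x ≢ root (C i) × ParentOf t y x × y ∉ nodes (C i)

  ExitChild : Fin k → MicroTree Node′ → Set
  ExitChild i ν = ∃[ x ] ∃[ y ] (nodes ν ≡ inj₁ y ∷ [] × ExitEdge i x y)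

  ExitChild-unique : ∀ i {ν₁ ν₂} → ExitChild i ν₁ → ExitChild i ν₂ → SameSet (nodes ν₁) (nodes ν₂)
  ExitChild-unique i (x₁ , y₁ , ν₁≡ , x₁∈ , x₁≢ , y₁→x₁ , y₁∉) (x₂ , y₂ , ν₂≡ , x₂∈ , x₂≢ , y₂→x₂ , y₂∉)
    with oneEdge i x₁ y₁ x₂ y₂ x₁∈ x₁≢ y₁→x₁ y₁∉ x₂∈ x₂≢ y₂→x₂ y₂∉
  ... | refl , refl rewrite ν₁≡ | ν₂≡ = id , id

  child-of-lower : ∀ d {ν} → ν ∈ cover′ → ChildMicro Par′ ν (lower d) → ExitChild (proj₁ d) ν
  child-of-lower d ν∈ (p , ν→p , p∈) with cover′-Piece ν∈ | ν→p
  ... | lowerPiece d′ | dummy .d′ = contradiction p∈ (root-∉-lower d (proj₁ d′))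
  ... | rootPiece j ys≡ | redirected _ q d″ y→q refl y∈ with refl ← dummy-∈-lower⁻ d p∈ =
    contradiction (root∈ (proj₁ d)) (parent-root∉ (micro (proj₁ d))
      (subst (λ y → ParentOf t y q) (root-∈⇒≡ (proj₁ d) j y∈) y→q))
  ... | rootPiece j ys≡ | kept _ x y→x _ with ∈-lower⁻ d p∈
  ...   | x∈ , x≢ = x , root (C j) , ys≡ , x∈ , x≢ , y→x , y∉
    where
      y∉ : root (C j) ∉ nodes (C (proj₁ d))
      y∉ y∈ = parent-root∉ (micro (proj₁ d)) (subst (λ y → ParentOf t y x) (root-∈⇒≡ (proj₁ d) j y∈) y→x) x∈

  cover′-shape : ∀ {μ} → μ ∈ cover′ →
     length (nodes μ) ≡ 1 ⊎
     (length (nodes μ) < 2 * B ×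
      (∀ {ν₁ ν₂} → ν₁ ∈ cover′ → ν₂ ∈ cover′ →
         ChildMicro Par′ ν₁ μ → ChildMicro Par′ ν₂ μ → SameSet (nodes ν₁) (nodes ν₂)))
  cover′-shape μ∈ with cover′-Piece μ∈
  ... | rootPiece j ys≡ = inj₁ (cong length ys≡)
  ... | lowerPiece d    = inj₂ (lower-small d , λ {ν₁} {ν₂} ν₁∈ ν₂∈ c₁ c₂ →
    ExitChild-unique (proj₁ d) {ν₁} {ν₂} (child-of-lower d ν₁∈ c₁) (child-of-lower d ν₂∈ c₂))

theorem7 : ∀ (c : ℕ) → ∃[ c′ ] (∀ (t : Tree) (B : ℕ) → 1 ≤ B →
    ∀ (k : ℕ) (C : Fin k → MicroTree (Pos t)) →
    FarzanMunroCover t B k C →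
    k * B ≤ c * (size t + B) →
    ModifiedCoverProperties t B k C c′)
theorem7 c = 2 * c , λ t B _ k C FM k*B≤ →
  let open Modified t k C in
  ( ( length cover′
    , (begin
        length cover′ * B       ≤⟨ *-monoˡ-≤ B (length-cover′ FM) ⟩
        2 * k * B               ≡⟨ *-assoc 2 k B ⟩
        2 * (k * B)             ≤⟨ *-monoʳ-≤ 2 k*B≤ ⟩
        2 * (c * (size t + B))  ≡⟨ *-assoc 2 c _ ⟨
        2 * c * (size t + B)    ∎)
    , cover′ , ≤-refl , λ {μ} μ∈ → μ , μ∈ , id , id)
  , cover′-shape FM )
  where open ≤-Reasoning
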